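{- In the type theory described in the context (with all the listed axioms), the countable lift property is derivable: for every family of types $P : \mathsf{N} \to \mathsf{Type}$ one can construct a term $\omega\mathsf{lift}_P : \big(\prod_{n:\mathsf{N}} \mathsf{M}(P\,n)\big) \to \mathsf{M}\big(\prod_{n:\mathsf{N}} P\,n\big)$ which is a section of $\mathsf{to\_fiber}^{\mathsf{M}}$, i.e. $\mathsf{to\_fiber}^{\mathsf{M}}(\omega\mathsf{lift}_P\, f) = f$ for every $f : \prod_{n:\mathsf{N}} \mathsf{M}(P\,n)$.
   Context: Work in an extensional dependent type theory with basic types $\mathsf{0},\mathsf{1},\mathsf{2},\mathsf{N},\mathsf{Z}$, a universe $\mathsf{Type}$, and a universe $\mathsf{Prop}\subseteq\mathsf{Type}$ of classical propositions (closed under $\to,\times,\Pi$, with classical $\lor$ and $\exists$; identity types lie in $\mathsf{Prop}$). Assume: excluded middle for $\mathsf{Prop}$; propositional extensionality $(P\leftrightarrow Q)\to P=Q$; functional extensionality for dependent functions; countable choice in the form $(\forall n.\,\exists x.\,P\,n\,x)\to\exists f.\,\forall n.\,P\,n\,(f\,n)$; Markov's principle $(\forall n.\,(f\,n)+\neg(f\,n))\to(\exists n.\,f\,n)\to\Sigma n.\,f\,n$ for $f:\mathsf{N}\to\mathsf{Prop}$. Nondeterminism: a type former $\mathsf{M}:\mathsf{Type}\to\mathsf{Type}$ with $\mathsf{unit}^{\mathsf{M}}_X : X\to\mathsf{M}X$, $\mathsf{mult}^{\mathsf{M}}_X:\mathsf{M}(\mathsf{M}X)\to\mathsf{M}X$,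 $\mathsf{lift}^{\mathsf{M}}_{X,Y}:(X\to Y)\to\mathsf{M}X\to\mathsf{M}Y$ satisfying the monad laws (naturality of unit and multiplication, unit laws, associativity). Let $\mathsf{P}_+X:=\Sigma(S:X\to\mathsf{Prop}).\,\exists x.\,S\,x$ be the classical nonempty-powerset monad (unit $x\mapsto(\lambda y.\,x=y)$, lift $f$ sends $S$ to $\lambda y.\,\exists z.\,y=f\,z\wedge S\,z$, mult takes unions). There is a natural transformation $\mathsf{picture}_X:\mathsf{M}X\to\mathsf{P}_+X$, injective for every $X$, commuting with units and multiplications, such that $\mathsf{lift}^{\mathsf{P}_+}\mathsf{picture}_X : \mathsf{P}_+(\mathsf{M}X)\to\mathsf{P}_+(\mathsf{P}_+X)$ is an equivalence; write $\mathsf{pic}_X\,x\,y:=\pi_1(\mathsf{picture}_X\,x)\,y$. There is a term of type $\prod_{x:\mathsf{M}X}\mathsf{M}(\Sigma y:X.\,\mathsf{pic}_X\,x\,y)$; if $X$ is a subsingleton ($\forall x,y:X.\,x=y$) then $\mathsf{unit}^{\mathsf{M}}_X$ is an equivalence. $\mathsf{M}$-dependent choice: for $P:\mathsf{N}\to\mathsf{Type}$ and $R:\prod_n P\,n\to P(n+1)\to\mathsf{Prop}$, an $\mathsf{M}$-trace of $R$ is $f:\prod_n\prod_{x:P\,n}\mathsf{M}(\Sigma y:P(n+1).\,R\,n\,x\,y)$; for every such trace (and initial value in $\mathsf{M}(P\,0)$) there is a term of $\mathsf{M}(\Sigma g:\prod_n P\,n.\,\forall m.\,R\,m\,(g\,m)\,(g(m+1)))$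 such that applying $\mathsf{to\_fiber}^{\mathsf{M}}$ to its $\mathsf{lift}^{\mathsf{M}}\pi_1$ equals the sequence in $\prod_n\mathsf{M}(P\,n)$ obtained by primitive recursion iterating $\lambda n\,x.\,\mathsf{mult}^{\mathsf{M}}(\mathsf{lift}^{\mathsf{M}}(\lambda z.\,\pi_1\ldots)(\ldots))$, i.e. iterating (the first projection of) $f$ from the initial value. Here $\mathsf{to\_fiber}^{\mathsf{M}}(g:\mathsf{M}\prod_n P\,n):=\lambda n.\,\mathsf{lift}^{\mathsf{M}}(\lambda h.\,h\,n)\,g$. -}

module Defs where

open import Level using (0ℓ)
open import Data.Nat using (ℕ; zero; suc)
open import Data.Product using (Σ; _×_; _,_; proj₁; proj₂)
open import Data.Sum using (_⊎_)
open import Relation.Nullary using (¬_)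
open import Relation.Binary.PropositionalEquality using (_≡_; refl)
open import Axiom.Extensionality.Propositional using (Extensionality)

isProp : Set → Set
isProp A = (a b : A) → a ≡ b

-- f is an equivalence (quasi-inverse; adequate since identity types are
-- propositions here: Agda's K is on, matching extensional type theory).
IsEquiv : {A B : Set} → (A → B) → Set
IsEquiv {A} {B} f = Σ (B → A) λ g → ((a : A) → g (f a) ≡ a) × ((b : B) → f (g b) ≡ b)

Injective : {A B : Set} → (A → B) → Set
Injective {A} f = (a a' : A) → f a ≡ f a' → a ≡ a'

-- The universe Prop of propositions, as a (Tarski-style, impredicative)
-- universe inside Type = Set.  Closure under
-- → , × , Π , ∨ , ∃ and identity types is obtained by truncating the
-- corresponding type formers (for subsingletons ‖ A ‖ ↔ A).

record PropUniverse : Set₁ where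
  field
    Ω        : Set
    El       : Ω → Set
    El-prop  : (p : Ω) → isProp (El p)
    ‖_‖      : Set → Ω
    ∣_∣      : {A : Set} → A → El ‖ A ‖
    ‖‖-rec   : {A Q : Set} → isProp Q → (A → Q) → El ‖ A ‖ → Q

module PropOps (U : PropUniverse) where
  open PropUniverse U

  ∃Ω : (X : Set) → (X → Ω) → Ω
  ∃Ω X S = ‖ Σ X (λ x → El (S x)) ‖

  P₊ : Set → Set
  P₊ X = Σ (X → Ω) (λ S → El (∃Ω X S))

  unitP : {X : Set} → X → P₊ X
  unitP x = (λ y → ‖ x ≡ y ‖) , ∣ (x , ∣ refl ∣) ∣

  liftP : {X Y : Set} → (X → Y) → P₊ X → P₊ Y
  liftP {X} {Y} f (S , ne) =
    (λ y → ‖ Σ X (λ z → (y ≡ f z) × El (S z)) ‖) ,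
    ‖‖-rec (El-prop _) (λ { (z , s) → ∣ (f z , ∣ (z , refl , s) ∣) ∣ }) ne

  multP : {X : Set} → P₊ (P₊ X) → P₊ X
  multP {X} (𝒮 , ne) =
    (λ x → ‖ Σ (P₊ X) (λ T → El (𝒮 T) × El (proj₁ T x)) ‖) ,
    ‖‖-rec (El-prop _)
      (λ { (T , inT) → ‖‖-rec (El-prop _)
             (λ { (x , inx) → ∣ (x , ∣ (T , inT , inx) ∣) ∣ }) (proj₂ T) })
      ne

record ClassicalAxioms (U : PropUniverse) : Set₁ where
  open PropUniverse U
  open PropOps U
  field
    lem       : (p : Ω) → El p ⊎ ¬ El p
    propext   : (p q : Ω) → (El p → El q) → (El q → El p) → p ≡ q
    funext    : Extensionality 0ℓ 0ℓ
    countable-choice : {X : Set} (P : ℕ → X → Ω) →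
      ((n : ℕ) → El (∃Ω X (P n))) →
      El (∃Ω (ℕ → X) (λ f → ‖ ((n : ℕ) → El (P n (f n))) ‖))
    markov    : (f : ℕ → Ω) → ((n : ℕ) → El (f n) ⊎ ¬ El (f n)) →
      El (∃Ω ℕ f) → Σ ℕ (λ n → El (f n))

toFiber : {M : Set → Set} → ({X Y : Set} → (X → Y) → M X → M Y) →
  {P : ℕ → Set} → M ((n : ℕ) → P n) → (n : ℕ) → M (P n)
toFiber liftM g n = liftM (λ h → h n) g

iterSeq : {M : Set → Set} → ({X : Set} → M (M X) → M X) →
  ({X Y : Set} → (X → Y) → M X → M Y) →
  (P : ℕ → Set) → ((n : ℕ) → P n → M (P (suc n))) →
  M (P 0) → (n : ℕ) → M (P n)
iterSeq multM liftM P step x₀ zero = x₀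
iterSeq multM liftM P step x₀ (suc n) =
  multM (liftM (step n) (iterSeq multM liftM P step x₀ n))

record Nondet (U : PropUniverse) : Set₁ where
  open PropUniverse U
  open PropOps U
  field
    M      : Set → Set
    unitM  : {X : Set} → X → M X
    multM  : {X : Set} → M (M X) → M X
    liftM  : {X Y : Set} → (X → Y) → M X → M Y
    liftM-id   : {X : Set} (m : M X) → liftM (λ x → x) m ≡ m
    liftM-comp : {X Y Z : Set} (g : Y → Z) (f : X → Y) (m : M X) →
      liftM (λ x → g (f x)) m ≡ liftM g (liftM f m)
    unitM-nat  : {X Y : Set} (f : X → Y) (x : X) → liftM f (unitM x) ≡ unitM (f x)
    multM-nat  : {X Y : Set} (f : X → Y) (m : M (M X)) →
      liftM f (multM m) ≡ multM (liftM (liftM f) m)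
    unitM-l    : {X : Set} (m : M X) → multM (unitM m) ≡ m
    unitM-r    : {X : Set} (m : M X) → multM (liftM unitM m) ≡ m
    multM-assoc : {X : Set} (m : M (M (M X))) →
      multM (multM m) ≡ multM (liftM multM m)
    picture     : {X : Set} → M X → P₊ X
    picture-nat : {X Y : Set} (f : X → Y) (m : M X) →
      picture (liftM f m) ≡ liftP f (picture m)
    picture-inj : {X : Set} → Injective (picture {X})
    picture-unit : {X : Set} (x : X) → picture (unitM x) ≡ unitP x
    picture-mult : {X : Set} (m : M (M X)) →
      picture (multM m) ≡ multP (liftP picture (picture m))
    liftP-picture-equiv : {X : Set} → IsEquiv (liftP (picture {X}))
    pic-choose : {X : Set} (x : M X) →
      M (Σ X (λ y → El (proj₁ (picture x) y)))
    unitM-subsingleton : {X : Set} → isProp X → IsEquiv (unitM {X})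
    dep-choice : (P : ℕ → Set) (R : (n : ℕ) → P n → P (suc n) → Ω)
      (f : (n : ℕ) (x : P n) → M (Σ (P (suc n)) (λ y → El (R n x y))))
      (x₀ : M (P 0)) →
      M (Σ ((n : ℕ) → P n) (λ g → (m : ℕ) → El (R m (g m) (g (suc m)))))
    dep-choice-eq : (P : ℕ → Set) (R : (n : ℕ) → P n → P (suc n) → Ω)
      (f : (n : ℕ) (x : P n) → M (Σ (P (suc n)) (λ y → El (R n x y))))
      (x₀ : M (P 0)) (n : ℕ) →
      toFiber liftM (liftM proj₁ (dep-choice P R f x₀)) n ≡
        iterSeq multM liftM P (λ k z → liftM proj₁ (f k z)) x₀ n

  pic : {X : Set} → M X → X → Set
  pic x y = El (proj₁ (picture x) y)

{-# OPTIONS --safe #-}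
-- Apply M-dependent choice to the trivial relation and to the trace that
-- ignores its input and returns f (n + 1).  Iterating such a trace from f 0
-- gives back f, because mult (lift (λ _ → m) m') = m: the map λ _ → m factors
-- through ⊤, and M ⊤ is a singleton since unit is an equivalence on subsingletons.
module Submission where

open import Level using (0ℓ)
open import Axiom.Extensionality.Propositional using (Extensionality)
open import Data.Nat using (ℕ; zero; suc)
open import Data.Product using (Σ; _,_; proj₁; proj₂)
open import Data.Unit using (⊤; tt)
open import Relation.Binary.PropositionalEquality using (_≡_; refl; sym; cong; module ≡-Reasoning)

open import Defs

module _ {U : PropUniverse} (N : Nondet U) where
  open PropUniverse U
  open Nondet N
  open ≡-Reasoning

  M⊤-isUnit : (m : M ⊤) → m ≡ unitM tt
  M⊤-isUnit m = sym (proj₂ (proj₂ (unitM-subsingleton (λ _ _ → refl))) m)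

  multM-liftM-const : {X Y : Set} (m : M Y) (m' : M X) → multM (liftM (λ _ → m) m') ≡ m
  multM-liftM-const m m' = begin
    multM (liftM (λ _ → m) m')                      ≡⟨ cong multM (liftM-comp (λ _ → m) (λ _ → tt) m') ⟩
    multM (liftM (λ _ → m) (liftM (λ _ → tt) m'))   ≡⟨ cong (λ t → multM (liftM (λ _ → m) t)) (M⊤-isUnit _) ⟩
    multM (liftM (λ _ → m) (unitM tt))              ≡⟨ cong multM (unitM-nat (λ _ → m) tt) ⟩
    multM (unitM m)                                 ≡⟨ unitM-l m ⟩
    m                                               ∎

  liftM-proj₁-pairing : {X : Set} {B : X → Set} (b : (x : X) → B x) (m : M X) →
    liftM proj₁ (liftM (λ x → x , b x) m) ≡ m
  liftM-proj₁-pairing b m = begin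
    liftM proj₁ (liftM (λ x → x , b x) m)   ≡⟨ sym (liftM-comp proj₁ (λ x → x , b x) m) ⟩
    liftM (λ x → x) m                       ≡⟨ liftM-id m ⟩
    m                                       ∎

  iterSeq-constStep : Extensionality 0ℓ 0ℓ → (P : ℕ → Set) (f : (n : ℕ) → M (P n))
    (step : (n : ℕ) → P n → M (P (suc n))) → (∀ n x → step n x ≡ f (suc n)) →
    ∀ n → iterSeq multM liftM P step (f 0) n ≡ f n
  iterSeq-constStep funext P f step step≡f zero = refl
  iterSeq-constStep funext P f step step≡f (suc n) = begin
    multM (liftM (step n) previous)              ≡⟨ cong (λ s → multM (liftM s previous)) (funext (step≡f n)) ⟩
    multM (liftM (λ _ → f (suc n)) previous)     ≡⟨ multM-liftM-const (f (suc n)) previous ⟩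
    f (suc n)                                    ∎
    where previous = iterSeq multM liftM P step (f 0) n

  module _ (P : ℕ → Set) (f : (n : ℕ) → M (P n)) where

    trivialRelation : (n : ℕ) → P n → P (suc n) → Ω
    trivialRelation _ _ _ = ‖ ⊤ ‖

    constTrace : (n : ℕ) (x : P n) → M (Σ (P (suc n)) (λ y → El (trivialRelation n x y)))
    constTrace n _ = liftM (λ y → y , ∣ tt ∣) (f (suc n))

    ωlift : M ((n : ℕ) → P n)
    ωlift = liftM proj₁ (dep-choice P trivialRelation constTrace (f 0))

    toFiber-ωlift : Extensionality 0ℓ 0ℓ → toFiber liftM ωlift ≡ f
    toFiber-ωlift funext = funext λ n → begin
      toFiber liftM ωlift n
        ≡⟨ dep-choice-eq P trivialRelation constTrace (f 0) n ⟩
      iterSeq multM liftM P (λ k z → liftM proj₁ (constTrace k z)) (f 0) n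
        ≡⟨ iterSeq-constStep funext P f _ (λ k _ → liftM-proj₁-pairing _ (f (suc k))) n ⟩
      f n ∎

mainTheorem1 : (U : PropUniverse) → ClassicalAxioms U → (N : Nondet U) →
    (P : ℕ → Set) →
    Σ (((n : ℕ) → Nondet.M N (P n)) → Nondet.M N ((n : ℕ) → P n))
      (λ ωlift → (f : (n : ℕ) → Nondet.M N (P n)) →
        toFiber (Nondet.liftM N) (ωlift f) ≡ f)
mainTheorem1 U axioms N P = ωlift N P , λ f → toFiber-ωlift N P f (ClassicalAxioms.funext axioms)
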